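{- Let $\mathcal{H}$ be a $4$-uniform hypergraph with $V(\mathcal{H})=A\cup B$, $A\cap B=\emptyset$, $|A|=|B|=n$. For any $c,c_1>0$, if $|\mathcal{H}(A,A,B,B)|<cn^4$ and $\delta_3(\mathcal{H})\geq (1-c_1)n$, then $|E(\mathcal{H}_0(A,B))\setminus E(\mathcal{H})|\leq \frac{1}{3}(c_1+4c)n^4+O(n^3)$.
   Context: $\mathcal{H}(A,A,B,B)=\{e\in E(\mathcal{H}):|e\cap A|=2\}$. $\delta_3(\mathcal{H})$ is the minimum over $3$-sets $T$ of vertices of the number of vertices $x$ with $T\cup\{x\}\in E(\mathcal{H})$. $\mathcal{H}_0(A,B)$ is the $4$-graph on $A\cup B$ whose edges are all $4$-sets meeting $A$ in exactly one or exactly three vertices.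
   Formalization: The constants $c,c_1$ range over the positive rationals. -}

module Defs where

open import Data.Bool using (Bool; true; false; _∧_; _∨_; not)
open import Data.Nat using (ℕ; zero; suc; _≡ᵇ_)
open import Data.Fin using (Fin)
open import Data.Fin.Subset using (Subset; inside; outside; ∣_∣; _∩_; _∪_; ⁅_⁆)
open import Data.List using (List; []; _∷_; map; _++_; filter; length; allFin)
open import Data.Vec using (Vec; lookup) renaming ([] to []ᵥ; _∷_ to _∷ᵥ_)
open import Data.Integer using (+_)
open import Data.Rational using (ℚ; _/_)
open import Relation.Binary.PropositionalEquality using (_≡_)
open import Relation.Nullary.Decidable using (does)
open import Data.Bool using (T?)

record Hypergraph4 (m : ℕ) : Set where
  field
    edge    : Subset m → Bool
    uniform : ∀ S → edge S ≡ true → ∣ S ∣ ≡ 4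
open Hypergraph4 public

allSubsets : (m : ℕ) → List (Subset m)
allSubsets zero    = []ᵥ ∷ []
allSubsets (suc m) = map (outside ∷ᵥ_) (allSubsets m) ++ map (inside ∷ᵥ_) (allSubsets m)

count : {X : Set} → (X → Bool) → List X → ℕ
count p xs = length (filter (λ x → T? (p x)) xs)

numAABB : {m : ℕ} → Hypergraph4 m → Subset m → ℕ
numAABB {m} H A = count (λ S → edge H S ∧ (∣ S ∩ A ∣ ≡ᵇ 2)) (allSubsets m)

-- Edge indicator of H₀(A,B): 4-sets meeting A in exactly 1 or exactly 3 vertices
-- (B is the complement of A in the vertex set).
H₀edge : {m : ℕ} → Subset m → Subset m → Bool
H₀edge A S = (∣ S ∣ ≡ᵇ 4) ∧ ((∣ S ∩ A ∣ ≡ᵇ 1) ∨ (∣ S ∩ A ∣ ≡ᵇ 3))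

numMissing : {m : ℕ} → Hypergraph4 m → Subset m → ℕ
numMissing {m} H A = count (λ S → H₀edge A S ∧ not (edge H S)) (allSubsets m)

codeg : {m : ℕ} → Hypergraph4 m → Subset m → ℕ
codeg {m} H T = count (λ x → edge H (T ∪ ⁅ x ⁆)) (allFin m)

toℚ : ℕ → ℚ
toℚ n = + n / 1

-- Double count the pairs (U, x) with U a 3-set of type AAB (two vertices in A, one in B = ∁ A) and
-- x ∉ U. Every x ∈ A ∖ U turns U into an AAAB set, which is an edge of H or a missing edge of H₀, and
-- every x ∈ B ∖ U with U ∪ {x} ∈ E(H) gives an AABB edge; hence for each such U
--   #(missing AAAB sets above U) + deg(U) ≤ |A| + #(AABB edges above U).
-- Summing over U counts each missing AAAB set three times and each AABB edge twice. Adding the same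
-- inequality with A and B exchanged gives 3 |E(H₀) ∖ E(H)| + Σ deg(U) ≤ n t + 4 |H(A,A,B,B)|, where
-- t = n²(n − 1) ≤ n³ is the number of triples of the two mixed types. The codegree condition gives
-- Σ deg(U) ≥ (1 − c₁) n t, so 3 |E(H₀) ∖ E(H)| ≤ c₁ n⁴ + 4 c n⁴ and no O(n³) term is needed.

module Submission where

open import Data.Bool using (Bool; true; false; T; _∧_; _∨_; not)
open import Data.Bool.Properties
  using (∧-assoc; ∧-comm; ∧-identityʳ; ∧-zeroʳ; ∨-identityʳ; not-involutive; T-∧; T-≡; T-not-≡)
open import Data.Fin using (Fin; zero; suc)
open import Data.Fin.Subset using (Subset; inside; outside; ∣_∣; _∩_; _∪_; ⁅_⁆; ∁; ⊥)
open import Data.Fin.Subset.Properties using (∪-identityʳ; ∣p∩q∣≤∣q∣; ∣∁p∣≡n∸∣p∣)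
open import Data.Integer as ℤ using (+_)
import Data.Integer.Properties as ℤ
open import Data.List using ([]; _∷_; map; _++_; tabulate; allFin)
open import Data.List.Properties using (map-++; map-∘)
open import Data.Nat as ℕ using (ℕ; zero; suc; _+_; _^_; _≥_; _≡ᵇ_) renaming (_*_ to _·_)
open import Data.Nat.Combinatorics using (_C_; nC1≡n; nCk+nC[k+1]≡[n+1]C[k+1])
open import Data.Nat.Coprimality using (1-coprimeTo)
import Data.Nat.Coprimality as Coprime
open import Data.Nat.ListAction using (sum)
open import Data.Nat.ListAction.Properties using (sum-++)
open import Data.Nat.Properties as ℕ
  using (+-*-semiring; +-commutativeSemigroup; +-identityʳ; +-suc; +-comm; *-comm; *-distribʳ-+; ≡ᵇ⇒≡; m+n∸m≡n)
open import Data.Nat.Tactic.RingSolver using (solve-∀)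
open import Data.Product using (∃-syntax; _×_; _,_; proj₁; proj₂)
open import Data.Rational using (ℚ; _/_; 0ℚ; 1ℚ; _<_; _≤_; _*_; _-_) renaming (_+_ to _+ℚ_)
import Data.Rational as ℚ
import Data.Rational.Properties as ℚ
open import Data.Rational.Solver using (module +-*-Solver)
open import Data.Vec using ([]; _∷_; lookup)
open import Data.Vec.Properties using (lookup-map)
open import Function using (_∘_; Equivalence)
open import Relation.Binary.PropositionalEquality
  using (_≡_; refl; sym; trans; cong; cong₂; subst; subst₂; module ≡-Reasoning)

open import Algebra.Properties.Semiring.Sum +-*-semiring
  using (sum-syntax; sum-cong-≗; ∑-distrib-+; *-distribˡ-sum)
open import Algebra.Properties.CommutativeSemigroup +-commutativeSemigroup
  using (x∙yz≈y∙xz; interchange)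

open import Defs

𝟙 : Bool → ℕ
𝟙 true  = 1
𝟙 false = 0

𝟙-∧ : ∀ b c → 𝟙 (b ∧ c) ≡ 𝟙 b · 𝟙 c
𝟙-∧ true  c = sym (+-identityʳ (𝟙 c))
𝟙-∧ false c = refl

𝟙-*-cong : ∀ b {m n} → (T b → m ≡ n) → 𝟙 b · m ≡ 𝟙 b · n
𝟙-*-cong true  m≡n = cong (_+ 0) (m≡n _)
𝟙-*-cong false m≡n = refl

guarded-cong : ∀ s a {b b′} → (T s → T a → b ≡ b′) → s ∧ a ∧ b ≡ s ∧ a ∧ b′
guarded-cong true  true  b≡b′ = b≡b′ _ _
guarded-cong true  false b≡b′ = refl
guarded-cong false a     b≡b′ = refl

∑ₛ : ∀ {m} → (Subset m → ℕ) → ℕ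
∑ₛ {zero}  f = f []
∑ₛ {suc m} f = ∑ₛ (λ S → f (outside ∷ S)) + ∑ₛ (λ S → f (inside ∷ S))

∑ₛ-cong : ∀ {m} {f g : Subset m → ℕ} → (∀ S → f S ≡ g S) → ∑ₛ f ≡ ∑ₛ g
∑ₛ-cong {zero}  f≗g = f≗g []
∑ₛ-cong {suc m} f≗g = cong₂ _+_ (∑ₛ-cong (f≗g ∘ (outside ∷_))) (∑ₛ-cong (f≗g ∘ (inside ∷_)))

∑ₛ-mono-≤ : ∀ {m} {f g : Subset m → ℕ} → (∀ S → f S ℕ.≤ g S) → ∑ₛ f ℕ.≤ ∑ₛ g
∑ₛ-mono-≤ {zero}  f≤g = f≤g []
∑ₛ-mono-≤ {suc m} f≤g = ℕ.+-mono-≤ (∑ₛ-mono-≤ (f≤g ∘ (outside ∷_))) (∑ₛ-mono-≤ (f≤g ∘ (inside ∷_)))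

∑ₛ-zero : ∀ m → ∑ₛ {m} (λ _ → 0) ≡ 0
∑ₛ-zero zero    = refl
∑ₛ-zero (suc m) = cong₂ _+_ (∑ₛ-zero m) (∑ₛ-zero m)

∑ₛ-distrib-+ : ∀ {m} (f g : Subset m → ℕ) → ∑ₛ (λ S → f S + g S) ≡ ∑ₛ f + ∑ₛ g
∑ₛ-distrib-+ {zero}  f g = refl
∑ₛ-distrib-+ {suc m} f g =
  trans (cong₂ _+_ (∑ₛ-distrib-+ (f ∘ (outside ∷_)) (g ∘ (outside ∷_)))
                   (∑ₛ-distrib-+ (f ∘ (inside ∷_)) (g ∘ (inside ∷_))))
        (interchange (∑ₛ (f ∘ (outside ∷_))) (∑ₛ (g ∘ (outside ∷_))) (∑ₛ (f ∘ (inside ∷_))) (∑ₛ (g ∘ (inside ∷_))))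

*-distribˡ-∑ₛ : ∀ {m} c (f : Subset m → ℕ) → c · ∑ₛ f ≡ ∑ₛ (λ S → c · f S)
*-distribˡ-∑ₛ {zero}  c f = refl
*-distribˡ-∑ₛ {suc m} c f =
  trans (ℕ.*-distribˡ-+ c _ _) (cong₂ _+_ (*-distribˡ-∑ₛ c (f ∘ (outside ∷_))) (*-distribˡ-∑ₛ c (f ∘ (inside ∷_))))

∑ₛ-comm-∑ : ∀ {m k} (f : Subset m → Fin k → ℕ) → ∑ₛ (λ S → ∑[ x < k ] f S x) ≡ ∑[ x < k ] ∑ₛ (λ S → f S x)
∑ₛ-comm-∑ {m} {zero}  f = ∑ₛ-zero m
∑ₛ-comm-∑ {m} {suc k} f =
  trans (∑ₛ-distrib-+ (λ S → f S zero) (λ S → ∑[ x < k ] f S (suc x)))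
        (cong (_+_ (∑ₛ (λ S → f S zero))) (∑ₛ-comm-∑ (λ S x → f S (suc x))))

count≡sum-map : ∀ {X : Set} (p : X → Bool) xs → count p xs ≡ sum (map (𝟙 ∘ p) xs)
count≡sum-map p []       = refl
count≡sum-map p (x ∷ xs) with p x
... | true  = cong suc (count≡sum-map p xs)
... | false = count≡sum-map p xs

count-allSubsets : ∀ {m} (p : Subset m → Bool) → count p (allSubsets m) ≡ ∑ₛ (𝟙 ∘ p)
count-allSubsets {m} p = trans (count≡sum-map p (allSubsets m)) (sum-map-allSubsets (𝟙 ∘ p))
  where
  sum-map-allSubsets : ∀ {m} (f : Subset m → ℕ) → sum (map f (allSubsets m)) ≡ ∑ₛ f
  sum-map-allSubsets {zero}  f = +-identityʳ (f [])
  sum-map-allSubsets {suc m} f = begin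
    sum (map f (map (outside ∷_) Ss ++ map (inside ∷_) Ss))
      ≡⟨ cong sum (map-++ f (map (outside ∷_) Ss) (map (inside ∷_) Ss)) ⟩
    sum (map f (map (outside ∷_) Ss) ++ map f (map (inside ∷_) Ss))
      ≡⟨ sum-++ (map f (map (outside ∷_) Ss)) (map f (map (inside ∷_) Ss)) ⟩
    sum (map f (map (outside ∷_) Ss)) + sum (map f (map (inside ∷_) Ss))
      ≡⟨ cong₂ _+_ (cong sum (map-∘ Ss)) (cong sum (map-∘ Ss)) ⟨
    sum (map (f ∘ (outside ∷_)) Ss) + sum (map (f ∘ (inside ∷_)) Ss)
      ≡⟨ cong₂ _+_ (sum-map-allSubsets (f ∘ (outside ∷_))) (sum-map-allSubsets (f ∘ (inside ∷_))) ⟩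
    ∑ₛ f ∎
    where
    open ≡-Reasoning
    Ss = allSubsets m

count-allFin : ∀ {m} (p : Fin m → Bool) → count p (allFin m) ≡ ∑[ x < m ] 𝟙 (p x)
count-allFin {m} p = trans (count≡sum-map p (allFin m)) (sum-map-tabulate (𝟙 ∘ p) (λ x → x))
  where
  sum-map-tabulate : ∀ {X : Set} {m} (f : X → ℕ) (g : Fin m → X) → sum (map f (tabulate g)) ≡ ∑[ x < m ] f (g x)
  sum-map-tabulate {m = zero}  f g = refl
  sum-map-tabulate {m = suc m} f g = cong (_+_ (f (g zero))) (sum-map-tabulate f (g ∘ suc))

∣x∷p∣≡𝟙x+∣p∣ : ∀ {n} b (p : Subset n) → ∣ b ∷ p ∣ ≡ 𝟙 b + ∣ p ∣
∣x∷p∣≡𝟙x+∣p∣ true  p = refl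
∣x∷p∣≡𝟙x+∣p∣ false p = refl

∣p∩q∣≡∑ : ∀ {n} (p q : Subset n) → ∣ p ∩ q ∣ ≡ ∑[ x < n ] 𝟙 (lookup p x ∧ lookup q x)
∣p∩q∣≡∑ []      []      = refl
∣p∩q∣≡∑ (b ∷ p) (c ∷ q) = trans (∣x∷p∣≡𝟙x+∣p∣ (b ∧ c) (p ∩ q)) (cong (_+_ (𝟙 (b ∧ c))) (∣p∩q∣≡∑ p q))

∣p∣≡∣p∩q∣+∣p∩∁q∣ : ∀ {n} (p q : Subset n) → ∣ p ∣ ≡ ∣ p ∩ q ∣ + ∣ p ∩ ∁ q ∣
∣p∣≡∣p∩q∣+∣p∩∁q∣ []          []          = refl
∣p∣≡∣p∩q∣+∣p∩∁q∣ (true  ∷ p) (true  ∷ q) = cong suc (∣p∣≡∣p∩q∣+∣p∩∁q∣ p q)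
∣p∣≡∣p∩q∣+∣p∩∁q∣ (true  ∷ p) (false ∷ q) = trans (cong suc (∣p∣≡∣p∩q∣+∣p∩∁q∣ p q)) (sym (+-suc _ _))
∣p∣≡∣p∩q∣+∣p∩∁q∣ (false ∷ p) (c     ∷ q) = ∣p∣≡∣p∩q∣+∣p∩∁q∣ p q

∁-involutive : ∀ {n} (p : Subset n) → ∁ (∁ p) ≡ p
∁-involutive []      = refl
∁-involutive (b ∷ p) = cong₂ _∷_ (not-involutive b) (∁-involutive p)

lookup-∁ : ∀ {n} (p : Subset n) x → lookup (∁ p) x ≡ not (lookup p x)
lookup-∁ p x = lookup-map x not p

p∪⁅x⁆≡p : ∀ {n} (p : Subset n) x → T (lookup p x) → p ∪ ⁅ x ⁆ ≡ p
p∪⁅x⁆≡p (true ∷ p) zero    _   = cong (true ∷_) (∪-identityʳ p)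
p∪⁅x⁆≡p (b    ∷ p) (suc x) x∈p = cong₂ _∷_ (∨-identityʳ b) (p∪⁅x⁆≡p p x x∈p)

∣p∪⁅x⁆∩q∣ : ∀ {n} (p q : Subset n) x → T (not (lookup p x)) →
            ∣ (p ∪ ⁅ x ⁆) ∩ q ∣ ≡ 𝟙 (lookup q x) + ∣ p ∩ q ∣
∣p∪⁅x⁆∩q∣ (false ∷ p) (c ∷ q) zero    _ =
  trans (∣x∷p∣≡𝟙x+∣p∣ c ((p ∪ ⊥) ∩ q)) (cong (λ r → 𝟙 c + ∣ r ∩ q ∣) (∪-identityʳ p))
∣p∪⁅x⁆∩q∣ (b     ∷ p) (c ∷ q) (suc x) x∉p = begin
  ∣ ((b ∨ false) ∧ c) ∷ ((p ∪ ⁅ x ⁆) ∩ q) ∣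
    ≡⟨ ∣x∷p∣≡𝟙x+∣p∣ ((b ∨ false) ∧ c) ((p ∪ ⁅ x ⁆) ∩ q) ⟩
  𝟙 ((b ∨ false) ∧ c) + ∣ (p ∪ ⁅ x ⁆) ∩ q ∣
    ≡⟨ cong₂ _+_ (cong (λ b′ → 𝟙 (b′ ∧ c)) (∨-identityʳ b)) (∣p∪⁅x⁆∩q∣ p q x x∉p) ⟩
  𝟙 (b ∧ c) + (𝟙 (lookup q x) + ∣ p ∩ q ∣)
    ≡⟨ x∙yz≈y∙xz (𝟙 (b ∧ c)) (𝟙 (lookup q x)) ∣ p ∩ q ∣ ⟩
  𝟙 (lookup q x) + (𝟙 (b ∧ c) + ∣ p ∩ q ∣)
    ≡⟨ cong (_+_ (𝟙 (lookup q x))) (∣x∷p∣≡𝟙x+∣p∣ (b ∧ c) (p ∩ q)) ⟨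
  𝟙 (lookup q x) + ∣ (b ∷ p) ∩ (c ∷ q) ∣ ∎
  where open ≡-Reasoning

∑ₚ : ∀ {m} → (Subset m → Fin m → ℕ) → ℕ
∑ₚ {m} f = ∑ₛ (λ U → ∑[ x < m ] f U x)

∑ₚ-cong : ∀ {m} {f g : Subset m → Fin m → ℕ} → (∀ U x → f U x ≡ g U x) → ∑ₚ f ≡ ∑ₚ g
∑ₚ-cong {m} f≗g = ∑ₛ-cong (λ U → sum-cong-≗ {m} (f≗g U))

∑ₚ-distrib-+ : ∀ {m} (f g : Subset m → Fin m → ℕ) → ∑ₚ (λ U x → f U x + g U x) ≡ ∑ₚ f + ∑ₚ g
∑ₚ-distrib-+ {m} f g =
  trans (∑ₛ-cong (λ U → ∑-distrib-+ (f U) (g U))) (∑ₛ-distrib-+ (λ U → ∑[ x < m ] f U x) (λ U → ∑[ x < m ] g U x))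

∑ₛ-insert-at : ∀ {m} x (g : Subset m → Bool) →
               ∑ₛ (λ U → 𝟙 (not (lookup U x) ∧ g (U ∪ ⁅ x ⁆))) ≡ ∑ₛ (λ S → 𝟙 (lookup S x ∧ g S))
∑ₛ-insert-at {suc m} zero    g =
  trans (+-comm (∑ₛ (λ U → 𝟙 (g (inside ∷ (U ∪ ⊥))))) (∑ₛ {m} (λ _ → 0)))
        (cong (_+_ (∑ₛ {m} (λ _ → 0))) (∑ₛ-cong (λ U → cong (λ U′ → 𝟙 (g (inside ∷ U′))) (∪-identityʳ U))))
∑ₛ-insert-at {suc m} (suc x) g =
  cong₂ _+_ (∑ₛ-insert-at x (g ∘ (outside ∷_))) (∑ₛ-insert-at x (g ∘ (inside ∷_)))

-- (U, x) ↦ (U ∪ ⁅ x ⁆, x) is a bijection from the pairs with x ∉ U onto the pairs with x ∈ S.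
∑ₚ-insert : ∀ {m} (g : Subset m → Fin m → Bool) →
            ∑ₚ (λ U x → 𝟙 (not (lookup U x) ∧ g (U ∪ ⁅ x ⁆) x)) ≡ ∑ₚ (λ S x → 𝟙 (lookup S x ∧ g S x))
∑ₚ-insert {m} g = begin
  ∑ₚ (λ U x → 𝟙 (not (lookup U x) ∧ g (U ∪ ⁅ x ⁆) x))
    ≡⟨ ∑ₛ-comm-∑ (λ U x → 𝟙 (not (lookup U x) ∧ g (U ∪ ⁅ x ⁆) x)) ⟩
  ∑[ x < m ] ∑ₛ (λ U → 𝟙 (not (lookup U x) ∧ g (U ∪ ⁅ x ⁆) x))
    ≡⟨ sum-cong-≗ {m} (λ x → ∑ₛ-insert-at x (λ S → g S x)) ⟩
  ∑[ x < m ] ∑ₛ (λ S → 𝟙 (lookup S x ∧ g S x))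
    ≡⟨ ∑ₛ-comm-∑ (λ S x → 𝟙 (lookup S x ∧ g S x)) ⟨
  ∑ₚ (λ S x → 𝟙 (lookup S x ∧ g S x)) ∎
  where open ≡-Reasoning

∑ₚ-insert-coloured : ∀ {m} (Q : Subset m) (P : Subset m → Bool) {k} →
                     (∀ S → T (P S) → ∣ S ∩ Q ∣ ≡ k) →
                     ∑ₚ (λ U x → 𝟙 (not (lookup U x) ∧ lookup Q x ∧ P (U ∪ ⁅ x ⁆))) ≡ k · ∑ₛ (𝟙 ∘ P)
∑ₚ-insert-coloured {m} Q P {k} ∣S∩Q∣≡k = begin
  ∑ₚ (λ U x → 𝟙 (not (lookup U x) ∧ lookup Q x ∧ P (U ∪ ⁅ x ⁆)))
    ≡⟨ ∑ₚ-insert (λ S x → lookup Q x ∧ P S) ⟩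
  ∑ₚ (λ S x → 𝟙 (lookup S x ∧ lookup Q x ∧ P S))
    ≡⟨ ∑ₛ-cong pull-out ⟩
  ∑ₛ (λ S → 𝟙 (P S) · ∣ S ∩ Q ∣)
    ≡⟨ ∑ₛ-cong (λ S → trans (𝟙-*-cong (P S) (∣S∩Q∣≡k S)) (*-comm (𝟙 (P S)) k)) ⟩
  ∑ₛ (λ S → k · 𝟙 (P S))
    ≡⟨ *-distribˡ-∑ₛ k (𝟙 ∘ P) ⟨
  k · ∑ₛ (𝟙 ∘ P) ∎
  where
  open ≡-Reasoning
  𝟙-∧-∧ : ∀ s c p → 𝟙 (s ∧ c ∧ p) ≡ 𝟙 p · 𝟙 (s ∧ c)
  𝟙-∧-∧ s c p = trans (cong 𝟙 (sym (∧-assoc s c p))) (trans (𝟙-∧ (s ∧ c) p) (*-comm (𝟙 (s ∧ c)) (𝟙 p)))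
  pull-out : ∀ S → ∑[ x < m ] 𝟙 (lookup S x ∧ lookup Q x ∧ P S) ≡ 𝟙 (P S) · ∣ S ∩ Q ∣
  pull-out S = begin
    ∑[ x < m ] 𝟙 (lookup S x ∧ lookup Q x ∧ P S)
      ≡⟨ sum-cong-≗ {m} (λ x → 𝟙-∧-∧ (lookup S x) (lookup Q x) (P S)) ⟩
    ∑[ x < m ] (𝟙 (P S) · 𝟙 (lookup S x ∧ lookup Q x))
      ≡⟨ *-distribˡ-sum (𝟙 (P S)) (λ x → 𝟙 (lookup S x ∧ lookup Q x)) ⟨
    𝟙 (P S) · ∑[ x < m ] 𝟙 (lookup S x ∧ lookup Q x)
      ≡⟨ cong (_·_ (𝟙 (P S))) (∣p∩q∣≡∑ S Q) ⟨
    𝟙 (P S) · ∣ S ∩ Q ∣ ∎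

hasType : ∀ {m} → Subset m → ℕ → ℕ → Subset m → Bool
hasType A i j S = (∣ S ∩ A ∣ ≡ᵇ i) ∧ (∣ S ∩ ∁ A ∣ ≡ᵇ j)

hasType⇒∣∩∣ : ∀ {m} (A S : Subset m) {i j} → T (hasType A i j S) → ∣ S ∩ A ∣ ≡ i × ∣ S ∩ ∁ A ∣ ≡ j
hasType⇒∣∩∣ A S {i} {j} h with Equivalence.to T-∧ h
... | hᵢ , hⱼ = ≡ᵇ⇒≡ _ i hᵢ , ≡ᵇ⇒≡ _ j hⱼ

hasType⇒∣∣ : ∀ {m} (A S : Subset m) {i j} → T (hasType A i j S) → ∣ S ∣ ≡ i + j
hasType⇒∣∣ A S h with hasType⇒∣∩∣ A S h
... | hᵢ , hⱼ = trans (∣p∣≡∣p∩q∣+∣p∩∁q∣ S A) (cong₂ _+_ hᵢ hⱼ)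

hasType-∁ : ∀ {m} (A S : Subset m) i j → hasType (∁ A) i j S ≡ hasType A j i S
hasType-∁ A S i j rewrite ∁-involutive A = ∧-comm (∣ S ∩ ∁ A ∣ ≡ᵇ i) (∣ S ∩ A ∣ ≡ᵇ j)

hasType-insert-∈ : ∀ {m} (A U : Subset m) x {i j} → T (not (lookup U x)) → T (lookup A x) →
                   hasType A (suc i) j (U ∪ ⁅ x ⁆) ≡ hasType A i j U
hasType-insert-∈ A U x x∉U x∈A
  rewrite ∣p∪⁅x⁆∩q∣ U A x x∉U | ∣p∪⁅x⁆∩q∣ U (∁ A) x x∉U | lookup-∁ A x | Equivalence.to T-≡ x∈A = refl

hasType-insert-∉ : ∀ {m} (A U : Subset m) x {i j} → T (not (lookup U x)) → T (not (lookup A x)) →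
                   hasType A i (suc j) (U ∪ ⁅ x ⁆) ≡ hasType A i j U
hasType-insert-∉ A U x x∉U x∉A
  rewrite ∣p∪⁅x⁆∩q∣ U A x x∉U | ∣p∪⁅x⁆∩q∣ U (∁ A) x x∉U | lookup-∁ A x | Equivalence.to T-not-≡ x∉A = refl

setsOfType : ∀ {m} → Subset m → ℕ → ℕ → ℕ
setsOfType A i j = ∑ₛ (𝟙 ∘ hasType A i j)

setsOfType≡ : ∀ {m} (A : Subset m) i j → setsOfType A i j ≡ (∣ A ∣ C i) · (∣ ∁ A ∣ C j)
setsOfType≡ []          zero    zero    = refl
setsOfType≡ []          zero    (suc j) = refl
setsOfType≡ []          (suc i) j       = refl
setsOfType≡ {suc m} (true ∷ A) zero j =
  trans (cong₂ _+_ (setsOfType≡ A zero j) (∑ₛ-zero m)) (+-identityʳ _)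
setsOfType≡ (true ∷ A) (suc i) j = begin
  setsOfType A (suc i) j + setsOfType A i j
    ≡⟨ cong₂ _+_ (setsOfType≡ A (suc i) j) (setsOfType≡ A i j) ⟩
  (∣ A ∣ C suc i) · (∣ ∁ A ∣ C j) + (∣ A ∣ C i) · (∣ ∁ A ∣ C j)
    ≡⟨ +-comm ((∣ A ∣ C suc i) · (∣ ∁ A ∣ C j)) _ ⟩
  (∣ A ∣ C i) · (∣ ∁ A ∣ C j) + (∣ A ∣ C suc i) · (∣ ∁ A ∣ C j)
    ≡⟨ *-distribʳ-+ (∣ ∁ A ∣ C j) (∣ A ∣ C i) (∣ A ∣ C suc i) ⟨
  ((∣ A ∣ C i) + (∣ A ∣ C suc i)) · (∣ ∁ A ∣ C j)
    ≡⟨ cong (_· (∣ ∁ A ∣ C j)) (nCk+nC[k+1]≡[n+1]C[k+1] ∣ A ∣ i) ⟩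
  (suc ∣ A ∣ C suc i) · (∣ ∁ A ∣ C j) ∎
  where open ≡-Reasoning
setsOfType≡ {suc m} (false ∷ A) i zero = begin
  setsOfType A i zero + ∑ₛ (λ S → 𝟙 ((∣ S ∩ A ∣ ≡ᵇ i) ∧ false))
    ≡⟨ cong₂ _+_ (setsOfType≡ A i zero) (trans (∑ₛ-cong (λ S → cong 𝟙 (∧-zeroʳ (∣ S ∩ A ∣ ≡ᵇ i)))) (∑ₛ-zero m)) ⟩
  (∣ A ∣ C i) · 1 + 0
    ≡⟨ +-identityʳ _ ⟩
  (∣ A ∣ C i) · 1 ∎
  where open ≡-Reasoning
setsOfType≡ (false ∷ A) i (suc j) = begin
  setsOfType A i (suc j) + setsOfType A i j
    ≡⟨ cong₂ _+_ (setsOfType≡ A i (suc j)) (setsOfType≡ A i j) ⟩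
  (∣ A ∣ C i) · (∣ ∁ A ∣ C suc j) + (∣ A ∣ C i) · (∣ ∁ A ∣ C j)
    ≡⟨ +-comm ((∣ A ∣ C i) · (∣ ∁ A ∣ C suc j)) _ ⟩
  (∣ A ∣ C i) · (∣ ∁ A ∣ C j) + (∣ A ∣ C i) · (∣ ∁ A ∣ C suc j)
    ≡⟨ ℕ.*-distribˡ-+ (∣ A ∣ C i) (∣ ∁ A ∣ C j) (∣ ∁ A ∣ C suc j) ⟨
  (∣ A ∣ C i) · ((∣ ∁ A ∣ C j) + (∣ ∁ A ∣ C suc j))
    ≡⟨ cong ((∣ A ∣ C i) ·_) (nCk+nC[k+1]≡[n+1]C[k+1] ∣ ∁ A ∣ j) ⟩
  (∣ A ∣ C i) · (suc ∣ ∁ A ∣ C suc j) ∎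
  where open ≡-Reasoning

-- Read s = [x ∈ U], a = [x ∈ A], τ = [U has type (2,1)], E = [U ∪ ⁅ x ⁆ ∈ E(H)]; the hypothesis
-- says that U itself, being a 3-set, is no edge.
insertion-identity : ∀ s a τ E → (T τ → T s → E ≡ false) →
  𝟙 (not s ∧ a ∧ τ ∧ not E) + 𝟙 (τ ∧ E) ≡ 𝟙 (τ ∧ not s ∧ a) + 𝟙 (not s ∧ not a ∧ τ ∧ E)
insertion-identity true  a     false E     _      = refl
insertion-identity true  a     true  E     E≡false rewrite E≡false _ _ = refl
insertion-identity false true  true  true  _      = refl
insertion-identity false true  true  false _      = refl
insertion-identity false true  false E     _      = refl
insertion-identity false false true  E     _      = refl
insertion-identity false false false E     _      = refl

module _ {m} (H : Hypergraph4 m) (A : Subset m) where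

  nonEdgesOfType edgesOfType codegreeSum : ℕ → ℕ → ℕ
  nonEdgesOfType i j = ∑ₛ (λ S → 𝟙 (hasType A i j S ∧ not (edge H S)))
  edgesOfType    i j = ∑ₛ (λ S → 𝟙 (hasType A i j S ∧ edge H S))
  codegreeSum    i j = ∑ₛ (λ U → 𝟙 (hasType A i j U) · codeg H U)

  type21⇒nonEdge : ∀ U → T (hasType A 2 1 U) → edge H U ≡ false
  type21⇒nonEdge U h with edge H U in isEdge
  ... | false = refl
  ... | true  with () ← trans (sym (hasType⇒∣∣ A U h)) (uniform H U isEdge)

  private
    τ : Subset m → Bool
    τ = hasType A 2 1

    e : Subset m → Bool
    e = edge H

  extendsToNonEdge extendsToEdge extendsIntoA extendsToEdgeOutsideA : Subset m → Fin m → Bool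
  extendsToNonEdge      U x = not (lookup U x) ∧ lookup A x ∧ τ U ∧ not (e (U ∪ ⁅ x ⁆))
  extendsToEdge         U x = τ U ∧ e (U ∪ ⁅ x ⁆)
  extendsIntoA          U x = τ U ∧ not (lookup U x) ∧ lookup A x
  extendsToEdgeOutsideA U x = not (lookup U x) ∧ not (lookup A x) ∧ τ U ∧ e (U ∪ ⁅ x ⁆)

  nonEdge-extensions : ∑ₚ (λ U x → 𝟙 (extendsToNonEdge U x)) ≡ 3 · nonEdgesOfType 3 1
  nonEdge-extensions = trans
    (∑ₚ-cong (λ U x → cong 𝟙 (guarded-cong (not (lookup U x)) (lookup A x)
       (λ x∉U x∈A → cong (_∧ not (e (U ∪ ⁅ x ⁆))) (sym (hasType-insert-∈ A U x x∉U x∈A))))))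
    (∑ₚ-insert-coloured A (λ S → hasType A 3 1 S ∧ not (e S))
       (λ S h → proj₁ (hasType⇒∣∩∣ A S (proj₁ (Equivalence.to T-∧ h)))))

  edgeOutsideA-extensions : ∑ₚ (λ U x → 𝟙 (extendsToEdgeOutsideA U x)) ≡ 2 · edgesOfType 2 2
  edgeOutsideA-extensions = trans
    (∑ₚ-cong (λ U x → cong 𝟙 (trans
       (guarded-cong (not (lookup U x)) (not (lookup A x))
         (λ x∉U x∉A → cong (_∧ e (U ∪ ⁅ x ⁆)) (sym (hasType-insert-∉ A U x x∉U x∉A))))
       (cong (λ a → not (lookup U x) ∧ a ∧ hasType A 2 2 (U ∪ ⁅ x ⁆) ∧ e (U ∪ ⁅ x ⁆)) (sym (lookup-∁ A x))))))
    (∑ₚ-insert-coloured (∁ A) (λ S → hasType A 2 2 S ∧ e S)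
       (λ S h → proj₂ (hasType⇒∣∩∣ A S (proj₁ (Equivalence.to T-∧ h)))))

  extensions-into-A : ∑ₚ (λ U x → 𝟙 (extendsIntoA U x)) ℕ.≤ ∣ A ∣ · setsOfType A 2 1
  extensions-into-A = begin
    ∑ₚ (λ U x → 𝟙 (extendsIntoA U x))
      ≡⟨ ∑ₛ-cong (λ U → trans (sum-cong-≗ {m} (λ x → 𝟙-∧ (τ U) (not (lookup U x) ∧ lookup A x)))
                              (sym (*-distribˡ-sum (𝟙 (τ U)) (λ x → 𝟙 (not (lookup U x) ∧ lookup A x))))) ⟩
    ∑ₛ (λ U → 𝟙 (τ U) · ∑[ x < m ] 𝟙 (not (lookup U x) ∧ lookup A x))
      ≡⟨ ∑ₛ-cong (λ U → cong (_·_ (𝟙 (τ U)))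
           (trans (sum-cong-≗ {m} (λ x → cong (λ s → 𝟙 (s ∧ lookup A x)) (sym (lookup-∁ U x))))
                  (sym (∣p∩q∣≡∑ (∁ U) A)))) ⟩
    ∑ₛ (λ U → 𝟙 (τ U) · ∣ ∁ U ∩ A ∣)
      ≤⟨ ∑ₛ-mono-≤ (λ U → ℕ.*-monoʳ-≤ (𝟙 (τ U)) (∣p∩q∣≤∣q∣ (∁ U) A)) ⟩
    ∑ₛ (λ U → 𝟙 (τ U) · ∣ A ∣)
      ≡⟨ ∑ₛ-cong (λ U → *-comm (𝟙 (τ U)) ∣ A ∣) ⟩
    ∑ₛ (λ U → ∣ A ∣ · 𝟙 (τ U))
      ≡⟨ *-distribˡ-∑ₛ ∣ A ∣ (𝟙 ∘ τ) ⟨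
    ∣ A ∣ · setsOfType A 2 1 ∎
    where open ℕ.≤-Reasoning

  codegree-extensions : ∑ₚ (λ U x → 𝟙 (extendsToEdge U x)) ≡ codegreeSum 2 1
  codegree-extensions = ∑ₛ-cong λ U → begin
    ∑[ x < m ] 𝟙 (τ U ∧ e (U ∪ ⁅ x ⁆))      ≡⟨ sum-cong-≗ {m} (λ x → 𝟙-∧ (τ U) (e (U ∪ ⁅ x ⁆))) ⟩
    ∑[ x < m ] (𝟙 (τ U) · 𝟙 (e (U ∪ ⁅ x ⁆)))  ≡⟨ *-distribˡ-sum (𝟙 (τ U)) (λ x → 𝟙 (e (U ∪ ⁅ x ⁆))) ⟨
    𝟙 (τ U) · ∑[ x < m ] 𝟙 (e (U ∪ ⁅ x ⁆))  ≡⟨ cong (_·_ (𝟙 (τ U))) (count-allFin (λ x → e (U ∪ ⁅ x ⁆))) ⟨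
    𝟙 (τ U) · codeg H U ∎
    where open ≡-Reasoning

  nonEdges-bound : 3 · nonEdgesOfType 3 1 + codegreeSum 2 1 ℕ.≤ ∣ A ∣ · setsOfType A 2 1 + 2 · edgesOfType 2 2
  nonEdges-bound = begin
    3 · nonEdgesOfType 3 1 + codegreeSum 2 1
      ≡⟨ cong₂ _+_ nonEdge-extensions codegree-extensions ⟨
    ∑ₚ (λ U x → 𝟙 (extendsToNonEdge U x)) + ∑ₚ (λ U x → 𝟙 (extendsToEdge U x))
      ≡⟨ ∑ₚ-distrib-+ (λ U x → 𝟙 (extendsToNonEdge U x)) (λ U x → 𝟙 (extendsToEdge U x)) ⟨
    ∑ₚ (λ U x → 𝟙 (extendsToNonEdge U x) + 𝟙 (extendsToEdge U x))
      ≡⟨ ∑ₚ-cong (λ U x → insertion-identity (lookup U x) (lookup A x) (τ U) (e (U ∪ ⁅ x ⁆))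
           (λ τU x∈U → trans (cong e (p∪⁅x⁆≡p U x x∈U)) (type21⇒nonEdge U τU))) ⟩
    ∑ₚ (λ U x → 𝟙 (extendsIntoA U x) + 𝟙 (extendsToEdgeOutsideA U x))
      ≡⟨ ∑ₚ-distrib-+ (λ U x → 𝟙 (extendsIntoA U x)) (λ U x → 𝟙 (extendsToEdgeOutsideA U x)) ⟩
    ∑ₚ (λ U x → 𝟙 (extendsIntoA U x)) + ∑ₚ (λ U x → 𝟙 (extendsToEdgeOutsideA U x))
      ≤⟨ ℕ.+-mono-≤ extensions-into-A (ℕ.≤-reflexive edgeOutsideA-extensions) ⟩
    ∣ A ∣ · setsOfType A 2 1 + 2 · edgesOfType 2 2 ∎
    where open ℕ.≤-Reasoning

numMissing≡ : ∀ {m} (H : Hypergraph4 m) A → numMissing H A ≡ nonEdgesOfType H A 3 1 + nonEdgesOfType H (∁ A) 3 1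
numMissing≡ H A = begin
  numMissing H A
    ≡⟨ count-allSubsets (λ S → H₀edge A S ∧ not (edge H S)) ⟩
  ∑ₛ (λ S → 𝟙 (H₀edge A S ∧ not (edge H S)))
    ≡⟨ ∑ₛ-cong split ⟩
  ∑ₛ (λ S → 𝟙 (hasType A 3 1 S ∧ not (edge H S)) + 𝟙 (hasType (∁ A) 3 1 S ∧ not (edge H S)))
    ≡⟨ ∑ₛ-distrib-+ (λ S → 𝟙 (hasType A 3 1 S ∧ not (edge H S)))
                    (λ S → 𝟙 (hasType (∁ A) 3 1 S ∧ not (edge H S))) ⟩
  nonEdgesOfType H A 3 1 + nonEdgesOfType H (∁ A) 3 1 ∎
  where
  open ≡-Reasoning
  oneOrThree : ∀ u w → 𝟙 ((u + w ≡ᵇ 4) ∧ ((u ≡ᵇ 1) ∨ (u ≡ᵇ 3)))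
                       ≡ 𝟙 ((u ≡ᵇ 3) ∧ (w ≡ᵇ 1)) + 𝟙 ((u ≡ᵇ 1) ∧ (w ≡ᵇ 3))
  oneOrThree 0 w = cong 𝟙 (∧-zeroʳ (w ≡ᵇ 4))
  oneOrThree 1 w = cong 𝟙 (∧-identityʳ (w ≡ᵇ 3))
  oneOrThree 2 w = cong 𝟙 (∧-zeroʳ (w ≡ᵇ 2))
  oneOrThree 3 w = trans (cong 𝟙 (∧-identityʳ (w ≡ᵇ 1))) (sym (+-identityʳ _))
  oneOrThree 4 w = cong 𝟙 (∧-zeroʳ (w ≡ᵇ 0))
  oneOrThree (suc (suc (suc (suc (suc u))))) w = cong 𝟙 (∧-zeroʳ (suc (suc (suc (suc (suc u)))) + w ≡ᵇ 4))
  split : ∀ S → 𝟙 (H₀edge A S ∧ not (edge H S))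
                ≡ 𝟙 (hasType A 3 1 S ∧ not (edge H S)) + 𝟙 (hasType (∁ A) 3 1 S ∧ not (edge H S))
  split S = begin
    𝟙 (H₀edge A S ∧ ne)
      ≡⟨ 𝟙-∧ (H₀edge A S) ne ⟩
    𝟙 (H₀edge A S) · 𝟙 ne
      ≡⟨ cong (λ k → 𝟙 ((k ≡ᵇ 4) ∧ meetsAOddly) · 𝟙 ne) (∣p∣≡∣p∩q∣+∣p∩∁q∣ S A) ⟩
    𝟙 ((∣ S ∩ A ∣ + ∣ S ∩ ∁ A ∣ ≡ᵇ 4) ∧ meetsAOddly) · 𝟙 ne
      ≡⟨ cong (_· 𝟙 ne) (oneOrThree ∣ S ∩ A ∣ ∣ S ∩ ∁ A ∣) ⟩
    (𝟙 (hasType A 3 1 S) + 𝟙 (hasType A 1 3 S)) · 𝟙 ne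
      ≡⟨ *-distribʳ-+ (𝟙 ne) (𝟙 (hasType A 3 1 S)) (𝟙 (hasType A 1 3 S)) ⟩
    𝟙 (hasType A 3 1 S) · 𝟙 ne + 𝟙 (hasType A 1 3 S) · 𝟙 ne
      ≡⟨ cong₂ _+_ (𝟙-∧ (hasType A 3 1 S) ne)
                   (trans (cong (λ b → 𝟙 (b ∧ ne)) (hasType-∁ A S 3 1)) (𝟙-∧ (hasType A 1 3 S) ne)) ⟨
    𝟙 (hasType A 3 1 S ∧ ne) + 𝟙 (hasType (∁ A) 3 1 S ∧ ne) ∎
    where
    ne = not (edge H S)
    meetsAOddly = (∣ S ∩ A ∣ ≡ᵇ 1) ∨ (∣ S ∩ A ∣ ≡ᵇ 3)

edgesOfType-∁ : ∀ {m} (H : Hypergraph4 m) A → edgesOfType H (∁ A) 2 2 ≡ edgesOfType H A 2 2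
edgesOfType-∁ H A = ∑ₛ-cong (λ S → cong (λ b → 𝟙 (b ∧ edge H S)) (hasType-∁ A S 2 2))

edgesOfType≡numAABB : ∀ {m} (H : Hypergraph4 m) A → edgesOfType H A 2 2 ≡ numAABB H A
edgesOfType≡numAABB H A = trans (∑ₛ-cong per-set) (sym (count-allSubsets (λ S → edge H S ∧ (∣ S ∩ A ∣ ≡ᵇ 2))))
  where
  twoTwo : ∀ u w → u + w ≡ 4 → (u ≡ᵇ 2) ∧ (w ≡ᵇ 2) ≡ (u ≡ᵇ 2)
  twoTwo 0 _ _    = refl
  twoTwo 1 _ _    = refl
  twoTwo 2 2 refl = refl
  twoTwo 3 _ _    = refl
  twoTwo 4 _ _    = refl
  twoTwo (suc (suc (suc (suc (suc u))))) _ _ = refl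
  per-set : ∀ S → 𝟙 (hasType A 2 2 S ∧ edge H S) ≡ 𝟙 (edge H S ∧ (∣ S ∩ A ∣ ≡ᵇ 2))
  per-set S with edge H S in isEdge
  ... | false = cong 𝟙 (∧-zeroʳ (hasType A 2 2 S))
  ... | true  = cong 𝟙 (trans (∧-identityʳ (hasType A 2 2 S))
                  (twoTwo ∣ S ∩ A ∣ ∣ S ∩ ∁ A ∣ (trans (sym (∣p∣≡∣p∩q∣+∣p∩∁q∣ S A)) (uniform H S isEdge))))

nC2+nC2+n≡n·n : ∀ n → n C 2 + n C 2 + n ≡ n · n
nC2+nC2+n≡n·n zero    = refl
nC2+nC2+n≡n·n (suc n) = begin
  suc n C 2 + suc n C 2 + suc n
    ≡⟨ cong (λ k → k + k + suc n) (nCk+nC[k+1]≡[n+1]C[k+1] n 1) ⟨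
  (n C 1 + n C 2) + (n C 1 + n C 2) + suc n
    ≡⟨ cong (λ k → (k + n C 2) + (k + n C 2) + suc n) (nC1≡n n) ⟩
  (n + n C 2) + (n + n C 2) + suc n
    ≡⟨ regroup n (n C 2) ⟩
  (n C 2 + n C 2 + n) + suc (n + n)
    ≡⟨ cong (λ k → k + suc (n + n)) (nC2+nC2+n≡n·n n) ⟩
  n · n + suc (n + n)
    ≡⟨ square-suc n ⟩
  suc n · suc n ∎
  where
  open ≡-Reasoning
  regroup : ∀ n c → (n + c) + (n + c) + suc n ≡ (c + c + n) + suc (n + n)
  regroup = solve-∀
  square-suc : ∀ n → n · n + suc (n + n) ≡ suc n · suc n
  square-suc = solve-∀

n·[nC2·n+nC2·n]≤n^4 : ∀ n → n · ((n C 2) · n + (n C 2) · n) ℕ.≤ n ^ 4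
n·[nC2·n+nC2·n]≤n^4 n = begin
  n · ((n C 2) · n + (n C 2) · n)  ≡⟨ reorder n (n C 2) ⟩
  (n · n) · (n C 2 + n C 2)        ≤⟨ ℕ.*-monoʳ-≤ (n · n) (ℕ.m+n≤o⇒m≤o (n C 2 + n C 2) 2nC2+n≤n·n) ⟩
  (n · n) · (n · n)                ≡⟨ fourth-power n ⟩
  n ^ 4 ∎
  where
  open ℕ.≤-Reasoning
  2nC2+n≤n·n : n C 2 + n C 2 + n ℕ.≤ n · n
  2nC2+n≤n·n = ℕ.≤-reflexive (nC2+nC2+n≡n·n n)
  reorder : ∀ n c → n · (c · n + c · n) ≡ (n · n) · (c + c)
  reorder = solve-∀
  fourth-power : ∀ n → (n · n) · (n · n) ≡ n · (n · (n · (n · 1)))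
  fourth-power = solve-∀

toℚ≡mkℚ : ∀ k → toℚ k ≡ ℚ.mkℚ (+ k) 0 (Coprime.sym (1-coprimeTo k))
toℚ≡mkℚ k = ℚ.normalize-coprime (Coprime.sym (1-coprimeTo k))

toℚ-+ : ∀ a b → toℚ (a + b) ≡ toℚ a +ℚ toℚ b
toℚ-+ a b rewrite toℚ≡mkℚ a | toℚ≡mkℚ b =
  cong (_/ 1) (trans (ℤ.pos-+ a b) (cong₂ ℤ._+_ (sym (ℤ.*-identityʳ (+ a))) (sym (ℤ.*-identityʳ (+ b)))))

toℚ-* : ∀ a b → toℚ (a · b) ≡ toℚ a * toℚ b
toℚ-* a b rewrite toℚ≡mkℚ a | toℚ≡mkℚ b = cong (_/ 1) (ℤ.pos-* a b)

toℚ-mono-≤ : ∀ {a b} → a ℕ.≤ b → toℚ a ≤ toℚ b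
toℚ-mono-≤ {a} {b} a≤b rewrite toℚ≡mkℚ a | toℚ≡mkℚ b =
  ℚ.*≤* (subst₂ ℤ._≤_ (sym (ℤ.*-identityʳ (+ a))) (sym (ℤ.*-identityʳ (+ b))) (ℤ.+≤+ a≤b))

toℚ-lowerBound-+ : ∀ {q} a a′ b b′ → q * toℚ a ≤ toℚ b → q * toℚ a′ ≤ toℚ b′ → q * toℚ (a + a′) ≤ toℚ (b + b′)
toℚ-lowerBound-+ {q} a a′ b b′ qa≤b qa′≤b′ = begin
  q * toℚ (a + a′)          ≡⟨ cong (q *_) (toℚ-+ a a′) ⟩
  q * (toℚ a +ℚ toℚ a′)     ≡⟨ ℚ.*-distribˡ-+ q (toℚ a) (toℚ a′) ⟩
  q * toℚ a +ℚ q * toℚ a′   ≤⟨ ℚ.+-mono-≤ qa≤b qa′≤b′ ⟩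
  toℚ b +ℚ toℚ b′           ≡⟨ toℚ-+ b b′ ⟨
  toℚ (b + b′) ∎
  where open ℚ.≤-Reasoning

∑ₛ-lowerBound : ∀ {m} (P : Subset m → Bool) (f : Subset m → ℕ) {q} → (∀ S → T (P S) → q ≤ toℚ (f S)) →
                q * toℚ (∑ₛ (𝟙 ∘ P)) ≤ toℚ (∑ₛ (λ S → 𝟙 (P S) · f S))
∑ₛ-lowerBound {zero} P f {q} q≤f with P [] | q≤f []
... | false | _    = ℚ.≤-reflexive (ℚ.*-zeroʳ q)
... | true  | q≤f₀ = begin
  q * toℚ 1       ≡⟨ ℚ.*-identityʳ q ⟩
  q               ≤⟨ q≤f₀ _ ⟩
  toℚ (f [])      ≡⟨ cong toℚ (+-identityʳ (f [])) ⟨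
  toℚ (f [] + 0)  ∎
  where open ℚ.≤-Reasoning
∑ₛ-lowerBound {suc m} P f {q} q≤f =
  toℚ-lowerBound-+ {q} (∑ₛ (𝟙 ∘ P₀)) (∑ₛ (𝟙 ∘ P₁)) (∑ₛ (λ S → 𝟙 (P₀ S) · f₀ S)) (∑ₛ (λ S → 𝟙 (P₁ S) · f₁ S))
    (∑ₛ-lowerBound P₀ f₀ (q≤f ∘ (outside ∷_))) (∑ₛ-lowerBound P₁ f₁ (q≤f ∘ (inside ∷_)))
  where
  P₀ P₁ : Subset m → Bool
  P₀ = P ∘ (outside ∷_)
  P₁ = P ∘ (inside ∷_)
  f₀ f₁ : Subset m → ℕ
  f₀ = f ∘ (outside ∷_)
  f₁ = f ∘ (inside ∷_)

bound-from-counts : ∀ {M D P E N c c₁} → 0ℚ ≤ c₁ →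
                    toℚ 3 * M +ℚ D ≤ P +ℚ toℚ 4 * E → (1ℚ - c₁) * P ≤ D → P ≤ N → E < c * N →
                    M ≤ (+ 1 / 3) * (c₁ +ℚ toℚ 4 * c) * N
bound-from-counts {M} {D} {P} {E} {N} {c} {c₁} 0≤c₁ counts degrees P≤N E<cN = ℚ.*-cancelˡ-≤-pos (toℚ 3) (begin
  toℚ 3 * M
    ≡⟨ solve 2 (λ m d → con (toℚ 3) :* m := (con (toℚ 3) :* m :+ d) :- d) refl M D ⟩
  (toℚ 3 * M +ℚ D) - D
    ≤⟨ ℚ.+-mono-≤ counts (ℚ.neg-antimono-≤ degrees) ⟩
  (P +ℚ toℚ 4 * E) - (1ℚ - c₁) * P
    ≡⟨ solve 3 (λ p e k → (p :+ con (toℚ 4) :* e) :- (con 1ℚ :- k) :* p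
                        := k :* p :+ con (toℚ 4) :* e) refl P E c₁ ⟩
  c₁ * P +ℚ toℚ 4 * E
    ≤⟨ ℚ.+-mono-≤ (ℚ.*-monoˡ-≤-nonNeg c₁ P≤N) (ℚ.*-monoˡ-≤-nonNeg (toℚ 4) (ℚ.<⇒≤ E<cN)) ⟩
  c₁ * N +ℚ toℚ 4 * (c * N)
    ≡⟨ solve 3 (λ k x z → k :* z :+ con (toℚ 4) :* (x :* z)
                        := con (toℚ 3) :* (con (+ 1 / 3) :* (k :+ con (toℚ 4) :* x) :* z)) refl c₁ c N ⟩
  toℚ 3 * ((+ 1 / 3) * (c₁ +ℚ toℚ 4 * c) * N) ∎)
  where
  open ℚ.≤-Reasoning
  open +-*-Solver
  instance
    _ = ℚ.nonNegative 0≤c₁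

module _ {n} (H : Hypergraph4 (n + n)) (A : Subset (n + n)) (∣A∣≡n : ∣ A ∣ ≡ n) where

  ∣∁A∣≡n : ∣ ∁ A ∣ ≡ n
  ∣∁A∣≡n = trans (∣∁p∣≡n∸∣p∣ A) (trans (cong (n + n ℕ.∸_) ∣A∣≡n) (m+n∸m≡n n n))

  triples codegrees : ℕ
  triples   = setsOfType A 2 1 + setsOfType (∁ A) 2 1
  codegrees = codegreeSum H A 2 1 + codegreeSum H (∁ A) 2 1

  counting-bound : 3 · numMissing H A + codegrees ℕ.≤ n · triples + 4 · numAABB H A
  counting-bound = subst (λ k → 3 · k + codegrees ℕ.≤ n · triples + 4 · numAABB H A) (sym (numMissing≡ H A))
    (combine (nonEdgesOfType H A 3 1) (nonEdgesOfType H (∁ A) 3 1) (codegreeSum H A 2 1) (codegreeSum H (∁ A) 2 1)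
             (setsOfType A 2 1) (setsOfType (∁ A) 2 1) (numAABB H A) sideA side∁A)
    where
    combine : ∀ a b d d′ t t′ e → 3 · a + d ℕ.≤ n · t + 2 · e → 3 · b + d′ ℕ.≤ n · t′ + 2 · e →
              3 · (a + b) + (d + d′) ℕ.≤ n · (t + t′) + 4 · e
    combine a b d d′ t t′ e ha hb = begin
      3 · (a + b) + (d + d′)           ≡⟨ regroupˡ a b d d′ ⟩
      (3 · a + d) + (3 · b + d′)       ≤⟨ ℕ.+-mono-≤ ha hb ⟩
      (n · t + 2 · e) + (n · t′ + 2 · e) ≡⟨ regroupʳ n t t′ e ⟩
      n · (t + t′) + 4 · e ∎
      where
      open ℕ.≤-Reasoning
      regroupˡ : ∀ a b d d′ → 3 · (a + b) + (d + d′) ≡ (3 · a + d) + (3 · b + d′)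
      regroupˡ = solve-∀
      regroupʳ : ∀ n t t′ e → (n · t + 2 · e) + (n · t′ + 2 · e) ≡ n · (t + t′) + 4 · e
      regroupʳ = solve-∀
    sideA : 3 · nonEdgesOfType H A 3 1 + codegreeSum H A 2 1 ℕ.≤ n · setsOfType A 2 1 + 2 · numAABB H A
    sideA = ℕ.≤-trans (nonEdges-bound H A)
      (ℕ.≤-reflexive (cong₂ (λ k l → k · setsOfType A 2 1 + 2 · l) ∣A∣≡n (edgesOfType≡numAABB H A)))
    side∁A : 3 · nonEdgesOfType H (∁ A) 3 1 + codegreeSum H (∁ A) 2 1 ℕ.≤ n · setsOfType (∁ A) 2 1 + 2 · numAABB H A
    side∁A = ℕ.≤-trans (nonEdges-bound H (∁ A))
      (ℕ.≤-reflexive (cong₂ (λ k l → k · setsOfType (∁ A) 2 1 + 2 · l) ∣∁A∣≡n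
                              (trans (edgesOfType-∁ H A) (edgesOfType≡numAABB H A))))

  n·triples≤n^4 : n · triples ℕ.≤ n ^ 4
  n·triples≤n^4 = subst (λ t → n · t ℕ.≤ n ^ 4)
    (sym (cong₂ _+_ (setsOfType21≡ A ∣A∣≡n ∣∁A∣≡n)
                    (setsOfType21≡ (∁ A) ∣∁A∣≡n (trans (cong ∣_∣ (∁-involutive A)) ∣A∣≡n))))
    (n·[nC2·n+nC2·n]≤n^4 n)
    where
    setsOfType21≡ : ∀ X → ∣ X ∣ ≡ n → ∣ ∁ X ∣ ≡ n → setsOfType X 2 1 ≡ (n C 2) · n
    setsOfType21≡ X ∣X∣≡n ∣∁X∣≡n =
      trans (setsOfType≡ X 2 1) (trans (cong₂ (λ a b → (a C 2) · (b C 1)) ∣X∣≡n ∣∁X∣≡n) (cong ((n C 2) ·_) (nC1≡n n)))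

  codegrees-lowerBound : ∀ {q} → ((U : Subset (n + n)) → ∣ U ∣ ≡ 3 → q ≤ toℚ (codeg H U)) →
                         q * toℚ triples ≤ toℚ codegrees
  codegrees-lowerBound {q} δ =
    toℚ-lowerBound-+ {q} (setsOfType A 2 1) (setsOfType (∁ A) 2 1) (codegreeSum H A 2 1) (codegreeSum H (∁ A) 2 1)
                             (∑ₛ-lowerBound (hasType A 2 1) (codeg H) (λ U h → δ U (hasType⇒∣∣ A U h)))
                             (∑ₛ-lowerBound (hasType (∁ A) 2 1) (codeg H) (λ U h → δ U (hasType⇒∣∣ (∁ A) U h)))

  missing-bound : ∀ {c c₁} → 0ℚ ≤ c₁ → toℚ (numAABB H A) < c * toℚ (n ^ 4) →
                  ((U : Subset (n + n)) → ∣ U ∣ ≡ 3 → (1ℚ - c₁) * toℚ n ≤ toℚ (codeg H U)) →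
                  toℚ (numMissing H A) ≤ ((+ 1 / 3) * (c₁ +ℚ (toℚ 4 * c))) * toℚ (n ^ 4)
  missing-bound {c} {c₁} 0≤c₁ few-AABB δ₃ =
    bound-from-counts {c = c} 0≤c₁ counts degrees (toℚ-mono-≤ n·triples≤n^4) few-AABB
    where
    counts : toℚ 3 * toℚ (numMissing H A) +ℚ toℚ codegrees ≤ toℚ (n · triples) +ℚ toℚ 4 * toℚ (numAABB H A)
    counts = subst₂ _≤_
      (trans (toℚ-+ (3 · numMissing H A) codegrees) (cong (_+ℚ toℚ codegrees) (toℚ-* 3 (numMissing H A))))
      (trans (toℚ-+ (n · triples) (4 · numAABB H A)) (cong (toℚ (n · triples) +ℚ_) (toℚ-* 4 (numAABB H A))))
      (toℚ-mono-≤ counting-bound)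
    degrees : (1ℚ - c₁) * toℚ (n · triples) ≤ toℚ codegrees
    degrees = subst (_≤ toℚ codegrees)
      (trans (ℚ.*-assoc (1ℚ - c₁) (toℚ n) (toℚ triples)) (cong ((1ℚ - c₁) *_) (sym (toℚ-* n triples))))
      (codegrees-lowerBound δ₃)

claim2p1 : (c c₁ : ℚ) → 0ℚ < c → 0ℚ < c₁ →
  ∃[ K ] ∃[ N ] ((n : ℕ) → n ≥ N →
    (A : Subset (n + n)) → ∣ A ∣ ≡ n →
    (H : Hypergraph4 (n + n)) →
    toℚ (numAABB H A) < c * toℚ (n ^ 4) →
    ((T : Subset (n + n)) → ∣ T ∣ ≡ 3 → (1ℚ - c₁) * toℚ n ≤ toℚ (codeg H T)) →
    toℚ (numMissing H A) ≤ ((+ 1 / 3) * (c₁ +ℚ (toℚ 4 * c))) * toℚ (n ^ 4) +ℚ K * toℚ (n ^ 3))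
claim2p1 c c₁ _ 0<c₁ = 0ℚ , 0 , λ n _ A ∣A∣≡n H few-AABB δ₃ →
  ℚ.≤-trans (missing-bound H A ∣A∣≡n {c} (ℚ.<⇒≤ 0<c₁) few-AABB δ₃)
            (ℚ.≤-reflexive (sym (no-error-term (((+ 1 / 3) * (c₁ +ℚ (toℚ 4 * c))) * toℚ (n ^ 4)) (toℚ (n ^ 3)))))
  where
  no-error-term : ∀ r x → r +ℚ 0ℚ * x ≡ r
  no-error-term r x = trans (cong (r +ℚ_) (ℚ.*-zeroˡ x)) (ℚ.+-identityʳ r)
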